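{- Let $G$ be a finite connected simple graph, let $G/\mathcal{R}$ be its maximal twin-free subgraph, and let $t(G)$ be the number of twin classes of $G$ having at least two vertices. Then $$\chi_{rlid}(G/\mathcal{R})-t(G)\leq \chi_{rlid}(G)\leq \chi_{rlid}(G/\mathcal{R}).$$
   Context: For a vertex $x$ of a graph, $N[x]$ denotes its closed neighborhood. Two distinct vertices $u,v$ are twins if $N[u]=N[v]$; "$N[u]=N[v]$" is an equivalence relation $\mathcal{R}$ on $V(G)$ whose classes are the twin classes. $G/\mathcal{R}$ denotes the maximal twin-free subgraph of $G$, i.e. the induced subgraph obtained by keeping exactly one vertex from each equivalence class of $\mathcal{R}$. A relaxed locally identifying coloring ($rlid$-coloring) of a graph $H$ is a map $c:V(H)\to\mathbb{N}$ (not necessarily proper) such that for every pair of adjacent vertices $u,v$ with $N[u]\neq N[v]$ we have $c(N[u])\neq c(N[v])$, where $c(X)=\{c(x):x\in X\}$. $\chi_{rlid}(H)$ is the minimum number of colors used by an $rlid$-coloring of $H$. -}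

module Defs where

open import Data.Nat using (ℕ; _≤_)
open import Data.Fin using (Fin; _≟_)
open import Data.Fin.Properties using (any?; all?)
open import Data.Bool using (Bool; true; false)
open import Data.Bool.Properties using () renaming (_≟_ to _≟ᵇ_)
open import Data.Product using (Σ; ∃; _×_; _,_)
open import Data.Sum using (_⊎_)
open import Data.List using (List; length; filter; allFin)
open import Relation.Nullary using (¬_; Dec)
open import Relation.Nullary.Decidable using (_×-dec_; _⊎-dec_; _→-dec_; ¬?)
open import Relation.Binary.PropositionalEquality using (_≡_; _≢_)

record Graph (n : ℕ) : Set where
  field
    adj        : Fin n → Fin n → Bool
    adj-sym    : ∀ u v → adj u v ≡ adj v u
    adj-irrefl : ∀ v → adj v v ≡ false
open Graph public

module _ {n : ℕ} (G : Graph n) where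

  Adj : Fin n → Fin n → Set
  Adj u v = adj G u v ≡ true

  InN : Fin n → Fin n → Set
  InN u x = x ≡ u ⊎ Adj u x

  SameN : Fin n → Fin n → Set
  SameN u v = ∀ x → (InN u x → InN v x) × (InN v x → InN u x)

  data Reach : Fin n → Fin n → Set where
    here : ∀ {u} → Reach u u
    step : ∀ {u v w} → Adj u v → Reach v w → Reach u w

  Connected : Set
  Connected = ∀ u v → Reach u v

  InColors : {k : ℕ} → (Fin n → Fin k) → Fin n → Fin k → Set
  InColors c u col = ∃ λ x → InN u x × c x ≡ col

  SameColorSet : {k : ℕ} → (Fin n → Fin k) → Fin n → Fin n → Set
  SameColorSet c u v =
    ∀ col → (InColors c u col → InColors c v col) × (InColors c v col → InColors c u col)

  IsRlid : {k : ℕ} → (Fin n → Fin k) → Set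
  IsRlid c = ∀ u v → Adj u v → ¬ SameN u v → ¬ SameColorSet c u v

  IsChiRlid : ℕ → Set
  IsChiRlid k =
    (Σ (Fin n → Fin k) IsRlid) × (∀ m → (c : Fin n → Fin m) → IsRlid c → k ≤ m)

  IsTwinRep : {m : ℕ} → (Fin m → Fin n) → Set
  IsTwinRep r =
    (∀ v → ∃ λ i → SameN v (r i)) × (∀ i j → SameN (r i) (r j) → i ≡ j)

  HasTwin : Fin n → Set
  HasTwin v = ∃ λ x → x ≢ v × SameN x v

  InN? : ∀ u x → Dec (InN u x)
  InN? u x = (x ≟ u) ⊎-dec (adj G u x ≟ᵇ true)

  SameN? : ∀ u v → Dec (SameN u v)
  SameN? u v = all? (λ x → (InN? u x →-dec InN? v x) ×-dec (InN? v x →-dec InN? u x))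

  HasTwin? : ∀ v → Dec (HasTwin v)
  HasTwin? v = any? (λ x → ¬? (x ≟ v) ×-dec SameN? x v)

induced : {n m : ℕ} → Graph n → (Fin m → Fin n) → Graph m
induced G r = record
  { adj        = λ i j → adj G (r i) (r j)
  ; adj-sym    = λ i j → adj-sym G (r i) (r j)
  ; adj-irrefl = λ i → adj-irrefl G (r i)
  }

twinCount : {n m : ℕ} → Graph n → (Fin m → Fin n) → ℕ
twinCount {m = m} G r = length (filter (λ i → HasTwin? G (r i)) (allFin m))

module Submission where

-- Twins are never separated by closed neighbourhoods, so an rlid-colouring of
-- H = G/R pulls back to G by colouring each vertex like the representative of its
-- twin class; hence χ(G) ≤ χ(H).  In the other direction, an rlid-colouring of G
-- restricted to H may lose colours that only deleted twins carried.  Giving each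
-- of the t(G) representatives of a twin class of size ≥ 2 a fresh private colour,
-- while twin-free vertices keep theirs, makes every colour set c(N[i]) in H
-- determine the colour set of N[i] in G, so χ(H) ≤ χ(G) + t(G).

open import Defs
open import Data.Nat using (ℕ; _≤_; _+_)
open import Data.Fin using (Fin; _≟_; join; splitAt)
open import Data.Fin.Properties using (splitAt-join)
open import Data.List using (length; filter; allFin)
open import Data.List.Membership.Propositional.Properties using (∈-filter⁺; ∈-allFin)
open import Data.List.Membership.Setoid.Properties using (index-injective)
open import Data.List.Relation.Unary.Any using (index)
open import Data.Product using (_×_; _,_; proj₁; proj₂)
open import Data.Sum using (_⊎_; inj₁; inj₂)
open import Data.Sum.Properties using (inj₁-injective; inj₂-injective)
open import Data.Empty using (⊥-elim)
open import Function using (_∘_; id)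
open import Relation.Nullary using (¬_; Dec; yes; no)
open import Relation.Unary using (Decidable)
open import Relation.Binary.PropositionalEquality
  using (_≡_; refl; sym; trans; cong; subst; setoid; module ≡-Reasoning)

join-injective : ∀ k t {a b : Fin k ⊎ Fin t} → join k t a ≡ join k t b → a ≡ b
join-injective k t {a} {b} e = begin
  a                      ≡⟨ splitAt-join k t a ⟨
  splitAt k (join k t a) ≡⟨ cong (splitAt k) e ⟩
  splitAt k (join k t b) ≡⟨ splitAt-join k t b ⟩
  b                      ∎
  where open ≡-Reasoning

module _ {m : ℕ} {P : Fin m → Set} (P? : Decidable P) where

  rank : (i : Fin m) → P i → Fin (length (filter P? (allFin m)))
  rank i p = index (∈-filter⁺ P? (∈-allFin i) p)

  rank-injective : ∀ {i j} (p : P i) (q : P j) → rank i p ≡ rank j q → i ≡ j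
  rank-injective p q =
    index-injective (setoid _) (∈-filter⁺ P? (∈-allFin _) p) (∈-filter⁺ P? (∈-allFin _) q)

module _ {n : ℕ} (G : Graph n) where

  InN-sym : ∀ {u x} → InN G u x → InN G x u
  InN-sym (inj₁ refl) = inj₁ refl
  InN-sym {u} {x} (inj₂ a) = inj₂ (trans (adj-sym G x u) a)

  SameN-refl : ∀ {u} → SameN G u u
  SameN-refl x = id , id

  SameN-sym : ∀ {u v} → SameN G u v → SameN G v u
  SameN-sym s x = proj₂ (s x) , proj₁ (s x)

  InN-resp-twin : ∀ {u x y} → SameN G x y → InN G u x → InN G u y
  InN-resp-twin s = InN-sym ∘ proj₁ (s _) ∘ InN-sym

module TwinQuotient {n : ℕ} (G : Graph n) {m : ℕ} (r : Fin m → Fin n) (isRep : IsTwinRep G r) where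

  H : Graph m
  H = induced G r

  rep : Fin n → Fin m
  rep v = proj₁ (proj₁ isRep v)

  rep-twin : ∀ v → SameN G v (r (rep v))
  rep-twin v = proj₂ (proj₁ isRep v)

  r-injective : ∀ {i j} → r i ≡ r j → i ≡ j
  r-injective {i} e = proj₂ isRep i _ (subst (SameN G (r i)) e (SameN-refl G))

  rep-r : ∀ i → rep (r i) ≡ i
  rep-r i = sym (proj₂ isRep i (rep (r i)) (rep-twin (r i)))

  twinFree-rep : ∀ {v} → ¬ HasTwin G (r (rep v)) → v ≡ r (rep v)
  twinFree-rep {v} noTwin with v ≟ r (rep v)
  ... | yes e = e
  ... | no v≢rep = ⊥-elim (noTwin (v , v≢rep , rep-twin v))

  InN-induced⁺ : ∀ {i j} → InN H i j → InN G (r i) (r j)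
  InN-induced⁺ (inj₁ e) = inj₁ (cong r e)
  InN-induced⁺ (inj₂ a) = inj₂ a

  InN-induced⁻ : ∀ {i j} → InN G (r i) (r j) → InN H i j
  InN-induced⁻ (inj₁ e) = inj₁ (r-injective e)
  InN-induced⁻ (inj₂ a) = inj₂ a

  InN-toRep : ∀ {i x} → InN G (r i) x → InN H i (rep x)
  InN-toRep {x = x} = InN-induced⁻ ∘ InN-resp-twin G (rep-twin x)

  InN-fromRep : ∀ {i x} → InN H i (rep x) → InN G (r i) x
  InN-fromRep {x = x} = InN-resp-twin G (SameN-sym G (rep-twin x)) ∘ InN-induced⁺

  InN-rep⁺ : ∀ {u x} → InN G u x → InN H (rep u) (rep x)
  InN-rep⁺ {u} {x} = InN-toRep ∘ proj₁ (rep-twin u x)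

  InN-rep⁻ : ∀ {u x} → InN H (rep u) (rep x) → InN G u x
  InN-rep⁻ {u} {x} = proj₂ (rep-twin u x) ∘ InN-fromRep

  SameN-rep⁻ : ∀ {u v} → SameN H (rep u) (rep v) → SameN G u v
  SameN-rep⁻ s x = InN-rep⁻ ∘ proj₁ (s (rep x)) ∘ InN-rep⁺ , InN-rep⁻ ∘ proj₂ (s (rep x)) ∘ InN-rep⁺

  SameN-induced⁻ : ∀ {i j} → SameN G (r i) (r j) → SameN H i j
  SameN-induced⁻ s k =
    InN-induced⁻ ∘ proj₁ (s (r k)) ∘ InN-induced⁺ , InN-induced⁻ ∘ proj₂ (s (r k)) ∘ InN-induced⁺

  Adj-rep : ∀ {u v} → Adj G u v → ¬ SameN G u v → Adj H (rep u) (rep v)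
  Adj-rep {u} {v} a notTwins with InN-rep⁺ {u} {v} (inj₂ a)
  ... | inj₁ e = ⊥-elim (notTwins (SameN-rep⁻ (subst (SameN H (rep u)) (sym e) (SameN-refl H))))
  ... | inj₂ b = b

  module _ {k : ℕ} (c : Fin m → Fin k) where

    InColors-rep⁺ : ∀ {u col} → InColors G (c ∘ rep) u col → InColors H c (rep u) col
    InColors-rep⁺ (x , h , e) = rep x , InN-rep⁺ h , e

    InColors-rep⁻ : ∀ {u col} → InColors H c (rep u) col → InColors G (c ∘ rep) u col
    InColors-rep⁻ {u} (i , h , e) =
      r i , InN-rep⁻ (subst (InN H (rep u)) (sym (rep-r i)) h) , trans (cong c (rep-r i)) e

    IsRlid-rep : IsRlid H c → IsRlid G (c ∘ rep)
    IsRlid-rep isRlid u v a notTwins same =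
      isRlid (rep u) (rep v) (Adj-rep a notTwins) (notTwins ∘ SameN-rep⁻) λ col →
        InColors-rep⁺ ∘ proj₁ (same col) ∘ InColors-rep⁻ ,
        InColors-rep⁺ ∘ proj₂ (same col) ∘ InColors-rep⁻

  SplitsTwins : ∀ {k k′} → (Fin n → Fin k) → (Fin m → Fin k′) → Set
  SplitsTwins c d = ∀ i j → d i ≡ d j → i ≡ j ⊎ (¬ HasTwin G (r i) × c (r i) ≡ c (r j))

  module _ {k k′ : ℕ} {c : Fin n → Fin k} {d : Fin m → Fin k′} (split : SplitsTwins c d) where

    InColors-descend : ∀ {i j} → (∀ col → InColors H d i col → InColors H d j col) →
      ∀ col → InColors G c (r i) col → InColors G c (r j) col
    InColors-descend incl col (x , h , e)
      with incl (d (rep x)) (rep x , InN-toRep h , refl)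
    ... | j′ , h′ , e′ with split (rep x) j′ (sym e′)
    ... | inj₁ refl = x , InN-fromRep h′ , e
    ... | inj₂ (noTwin , sameColour) = r j′ , InN-induced⁺ h′ , (begin
      c (r j′)      ≡⟨ sameColour ⟨
      c (r (rep x)) ≡⟨ cong c (twinFree-rep noTwin) ⟨
      c x           ≡⟨ e ⟩
      col           ∎)
      where open ≡-Reasoning

    IsRlid-descend : IsRlid G c → IsRlid H d
    IsRlid-descend isRlid i j a notTwins same =
      isRlid (r i) (r j) a (notTwins ∘ SameN-induced⁻) λ col →
        InColors-descend (λ col′ → proj₁ (same col′)) col ,
        InColors-descend (λ col′ → proj₂ (same col′)) col

  twinRank : (i : Fin m) → HasTwin G (r i) → Fin (twinCount G r)
  twinRank = rank (λ i → HasTwin? G (r i))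

  module _ {k : ℕ} (c : Fin n → Fin k) where

    recolourWith : (i : Fin m) → Dec (HasTwin G (r i)) → Fin k ⊎ Fin (twinCount G r)
    recolourWith i (yes p) = inj₂ (twinRank i p)
    recolourWith i (no _)  = inj₁ (c (r i))

    recolour : Fin m → Fin (k + twinCount G r)
    recolour i = join k (twinCount G r) (recolourWith i (HasTwin? G (r i)))

    recolourWith-splits : ∀ {i j} (di : Dec (HasTwin G (r i))) (dj : Dec (HasTwin G (r j))) →
      recolourWith i di ≡ recolourWith j dj → i ≡ j ⊎ (¬ HasTwin G (r i) × c (r i) ≡ c (r j))
    recolourWith-splits (yes p) (yes q) e = inj₁ (rank-injective _ p q (inj₂-injective e))
    recolourWith-splits (no ¬p) (no ¬q) e = inj₂ (¬p , inj₁-injective e)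
    recolourWith-splits (yes p) (no ¬q) ()
    recolourWith-splits (no ¬p) (yes q) ()

    recolour-splits : SplitsTwins c recolour
    recolour-splits i j e =
      recolourWith-splits (HasTwin? G (r i)) (HasTwin? G (r j)) (join-injective k (twinCount G r) e)

mainTheorem1 : {n : ℕ} (G : Graph n) → Connected G →
    {m : ℕ} (r : Fin m → Fin n) → IsTwinRep G r →
    (χG χGR : ℕ) → IsChiRlid G χG → IsChiRlid (induced G r) χGR →
    (χGR ≤ χG + twinCount G r) × (χG ≤ χGR)
mainTheorem1 G _ r isRep χG χGR ((c , cRlid) , χG-minimal) ((d , dRlid) , χGR-minimal) =
  χGR-minimal _ (recolour c) (IsRlid-descend (recolour-splits c) cRlid) ,
  χG-minimal χGR (d ∘ rep) (IsRlid-rep d dRlid)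
  where open TwinQuotient G r isRep
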